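{- Let $(h_k)_{k\ge0}$ be the Fibonacci sequence ($h_0=0,h_1=1,h_k=h_{k-1}+h_{k-2}$). For each even natural number $n$, let $p_n$ and $q_n$ be primes such that $\dfrac{h_n}{h_{n-1}}<\dfrac{\log q_n}{\log p_n}<\dfrac{h_{n+1}}{h_n}$, and set $\alpha_n=p_n^{h_{n+1}}/q_n^{h_n}$. Then $\log(\#\mathcal V(\alpha_n))\ll(\log h_{n+1})^2$, i.e., there is an absolute constant $C>0$ such that $\log(\#\mathcal V(\alpha_n))\le C(\log h_{n+1})^2$ for all even $n\ge 2$.
   Context: $\mathbb N_0=\{0,1,2,\dots\}$, $\mathcal N=\{(a,b)\in\mathbb N_0^2:(a,b)\neq(0,0)\}$, $\mathcal G=\{(a,b)\in\mathcal N:\gcd(a,b)=1\}$ (convention $\gcd(a,0)=a$; $a/0=\infty$ for $a\in\mathbb N$). For positive irrational $\xi$: $\mathcal U(\xi)=\{(a,b)\in\mathcal N:a>b\xi\}$, $\mathcal L(\xi)=\{(a,b)\in\mathcal N:a<b\xi\}$, $\mathcal U_1(\xi)=\{(a,b)\in\mathcal U(\xi): a/b=\min\{m/n:(m,n)\in\mathcal U(\xi),\ m\le a\}\}$, $\mathcal L_2(\xi)=\{(a,b)\in\mathcal L(\xi): a/b=\max\{m/n:(m,n)\in\mathcal L(\xi),\ n\le b\}\}$; upper (resp. lower) best approximations for $\xi$ are elements of $\mathcal G\cap\mathcal U_1(\xi)$ (resp. $\mathcal G\cap\mathcal L_2(\xi)$). For primes $p<q$, $\xi=\log q/\log p$, $(a,b)$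 an upper or lower best approximation for $\xi$ and $\alpha=p^a/q^b$: let $(a_1,b_1),\dots,(a_N,b_N)$ be the complete list of upper or lower best approximations to $\xi$ with $a_k\le a$, $b_k\le b$ (ordered by $b_k$, ties by $a_k$), and let $T_\alpha:\mathbb R^N\to\mathbb R^2$ be the linear map with matrix rows $(a_1,\dots,a_N)$ and $(b_1,\dots,b_N)$. Then $\mathcal V(\alpha)=\{\mathbf x\in\mathbb N_0^N: T_\alpha(\mathbf x)=(a,b)^T\}$ (the set of factorization vectors). (Under the hypotheses of the claim, $(h_{n+1},h_n)$ is such a best approximation and $q_n>p_n$, so $\mathcal V(\alpha_n)$ is defined.) -}

module Defs where

open import Data.Nat using (ℕ; zero; suc; _+_; _*_; _^_; _≤_; _<_)
open import Data.Nat.Coprimality using (Coprime)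
open import Data.Product using (_×_; _,_; Σ)
open import Data.Sum using (_⊎_)
open import Data.List using (List; []; _∷_; length)
open import Data.List.Membership.Propositional using (_∈_)
open import Data.List.Relation.Unary.Linked using (Linked)
open import Data.Vec using (Vec; []; _∷_)
open import Relation.Binary.PropositionalEquality using (_≡_)
open import Relation.Nullary using (¬_)
open import Function.Bundles using (_⇔_)

fib : ℕ → ℕ
fib zero = 0
fib (suc zero) = 1
fib (suc (suc k)) = fib (suc k) + fib k

-- Throughout, ξ = log q / log p for primes p, q.
-- Since log p > 0:  a > b ξ  ⇔  p ^ a > q ^ b,  and  a < b ξ  ⇔  p ^ a < q ^ b.

NonZeroPair : ℕ → ℕ → Set
NonZeroPair a b = ¬ (a ≡ 0 × b ≡ 0)

InU : (p q a b : ℕ) → Set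
InU p q a b = NonZeroPair a b × q ^ b < p ^ a

InL : (p q a b : ℕ) → Set
InL p q a b = NonZeroPair a b × p ^ a < q ^ b

-- a/b ≤ m/n in [0,∞] with convention x/0 = ∞ (x ≥ 1), via cross-multiplication
RatioLe : (a b m n : ℕ) → Set
RatioLe a b m n = a * n ≤ m * b

-- 𝒰₁(ξ): a/b = min { m/n : (m,n) ∈ 𝒰(ξ), m ≤ a }  (a/b itself belongs to the set)
InU1 : (p q a b : ℕ) → Set
InU1 p q a b = InU p q a b × (∀ m n → InU p q m n → m ≤ a → RatioLe a b m n)

-- ℒ₂(ξ): a/b = max { m/n : (m,n) ∈ ℒ(ξ), n ≤ b }
InL2 : (p q a b : ℕ) → Set
InL2 p q a b = InL p q a b × (∀ m n → InL p q m n → n ≤ b → RatioLe m n a b)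

-- upper or lower best approximation (element of 𝒢 ∩ (𝒰₁ ∪ ℒ₂)); gcd(a,0)=a in stdlib
IsBestApprox : (p q a b : ℕ) → Set
IsBestApprox p q a b = Coprime a b × (InU1 p q a b ⊎ InL2 p q a b)

LexLt : ℕ × ℕ → ℕ × ℕ → Set
LexLt (a₁ , b₁) (a₂ , b₂) = b₁ < b₂ ⊎ (b₁ ≡ b₂ × a₁ < a₂)

IsBestApproxList : (p q a b : ℕ) → List (ℕ × ℕ) → Set
IsBestApproxList p q a b L =
  (∀ a' b' → ((a' , b') ∈ L) ⇔ (IsBestApprox p q a' b' × a' ≤ a × b' ≤ b))
  × Linked LexLt L

T : (L : List (ℕ × ℕ)) → Vec ℕ (length L) → ℕ × ℕ
T [] [] = 0 , 0
T ((ak , bk) ∷ L) (x ∷ xs) with T L xs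
... | (s , t) = x * ak + s , x * bk + t

FactVec : (L : List (ℕ × ℕ)) (a b : ℕ) → Set
FactVec L a b = Σ (Vec ℕ (length L)) (λ x → T L x ≡ (a , b))

-- Write n = 2T and ξ = log q / log p. Consecutive Fibonacci convergents h (k+1) / h k of the golden
-- ratio are Farey neighbours, and each is the mediant of the two before it. Since ξ lies between
-- h n / h (n-1) and h (n+1) / h n, mediants propagate this downwards: every convergent of index ≤ n
-- lies on the same side of ξ as of the golden ratio. A best approximation a / b with a ≤ h (n+1),
-- b ≤ h n that is not a convergent lies strictly between two neighbouring convergents on opposite
-- sides of ξ, so its numerator (upper case) or denominator (lower case) is at least that of their
-- mediant, the next convergent; climbing index by index it would exceed the convergent of index n.
-- Hence the best approximations are among the n + 1 convergents, every factorisation vector has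
-- entries ≤ h (n+1) < 2 ^ (n+1), and # 𝒱 ≤ 2 ^ ((n+1)²) with n + 1 ≤ 3 ⌈log₂ h (n+1)⌉.
{-# OPTIONS --safe #-}
module Submission where

open import Defs
open import Data.Nat using
  ( ℕ; zero; suc; _+_; _*_; _^_; _∸_; _≤_; _<_; _≤′_; ≤′-refl; ≤′-step; z≤n; s≤s; z<s
  ; >-nonZero; nonTrivial⇒n>1)
open import Data.Nat.Properties
open import Data.Nat.Tactic.RingSolver using (solve)
open import Data.Nat.Divisibility using (_∣_; divides; ∣-antisym; ∣m+n∣m⇒∣n; ∣1⇒≡1)
open import Data.Nat.Coprimality using (Coprime; coprime-divisor)
import Data.Nat.Coprimality as Coprime
open import Data.Nat.Primality using (Prime; prime⇒nonTrivial)
open import Data.Nat.Logarithm using (⌈log₂_⌉; ⌈log₂2^n⌉≡n; ⌈log₂⌉-mono-≤)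
open import Data.Product using (Σ; _×_; _,_; proj₁; proj₂; swap)
open import Data.Product.Properties using (Σ-≡,≡→≡)
open import Data.Sum using (_⊎_; inj₁; inj₂; map₁)
open import Data.List using (List; []; _∷_; length)
open import Data.Fin using (Fin; toℕ; fromℕ<)
open import Data.Fin.Properties using (toℕ-fromℕ<; injective⇒≤)
open import Function using (id; _∘_; case_of_)
open import Function.Bundles using (_↔_; _↣_; Injection; Equivalence; mk↣)
open import Function.Construct.Composition using (_↣-∘_; _↔-∘_)
open import Function.Properties.Inverse using (↔⇒↣; ↔-sym)
open import Axiom.UniquenessOfIdentityProofs.WithK using (uip)
open import Relation.Binary.PropositionalEquality
  using (_≡_; refl; sym; trans; cong; cong₂; subst; subst₂; module ≡-Reasoning)
open import Data.Empty using (⊥-elim)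

double : ℕ → ℕ
double zero    = zero
double (suc n) = suc (suc (double n))

double≡*2 : ∀ n → double n ≡ n * 2
double≡*2 zero    = refl
double≡*2 (suc n) = cong (suc ∘ suc) (double≡*2 n)

double-mono-≤ : ∀ {m n} → m ≤ n → double m ≤ double n
double-mono-≤ z≤n       = z≤n
double-mono-≤ (s≤s m≤n) = s≤s (s≤s (double-mono-≤ m≤n))

even⇒double : ∀ {n} → 2 ∣ n → 2 ≤ n → Σ ℕ λ t → n ≡ double (suc t)
even⇒double (divides zero    n≡0)   2≤n = ⊥-elim (<⇒≱ 2≤n (≤-trans (≤-reflexive n≡0) z≤n))
even⇒double (divides (suc t) n≡t*2) _   = t , trans n≡t*2 (sym (double≡*2 (suc t)))

≤-downward-induction : ∀ {P : ℕ → Set} → (∀ {i} → P (suc i) → P i)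
                     → ∀ {i j} → i ≤ j → P j → P i
≤-downward-induction {P} step i≤j = go (≤⇒≤′ i≤j)
  where
  go : ∀ {i j} → i ≤′ j → P j → P i
  go ≤′-refl        = id
  go (≤′-step i≤′j) = go i≤′j ∘ step

fib[1+k]>0 : ∀ k → 0 < fib (suc k)
fib[1+k]>0 zero    = z<s
fib[1+k]>0 (suc k) = ≤-trans (fib[1+k]>0 k) (m≤m+n _ _)

fib≤fib[1+k] : ∀ k → fib k ≤ fib (suc k)
fib≤fib[1+k] zero    = z≤n
fib≤fib[1+k] (suc k) = m≤m+n _ _

fib-mono-≤ : ∀ {j k} → j ≤ k → fib j ≤ fib k
fib-mono-≤ j≤k = go (≤⇒≤′ j≤k)
  where
  go : ∀ {j k} → j ≤′ k → fib j ≤ fib k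
  go ≤′-refl                    = ≤-refl
  go {k = suc k} (≤′-step j≤′k) = ≤-trans (go j≤′k) (fib≤fib[1+k] k)

consecutive-fib-coprime : ∀ k → Coprime (fib (suc k)) (fib k)
consecutive-fib-coprime zero    (d∣1 , _) = ∣1⇒≡1 d∣1
consecutive-fib-coprime (suc k) (d∣fib[k+2] , d∣fib[k+1]) =
  consecutive-fib-coprime k (d∣fib[k+1] , ∣m+n∣m⇒∣n d∣fib[k+2] d∣fib[k+1])

fib<2^ : ∀ k → fib k < 2 ^ k
fib<2^ zero          = z<s
fib<2^ (suc zero)    = s≤s (s≤s z≤n)
fib<2^ (suc (suc k)) = begin-strict
  fib (suc k) + fib k     <⟨ +-mono-<-≤ (fib<2^ (suc k)) (<⇒≤ (fib<2^ k)) ⟩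
  2 ^ suc k + 2 ^ k       ≤⟨ +-monoʳ-≤ (2 ^ suc k) (^-monoʳ-≤ 2 (n≤1+n k)) ⟩
  2 ^ suc k + 2 ^ suc k   ≡⟨ cong (2 ^ suc k +_) (+-identityʳ (2 ^ suc k)) ⟨
  2 ^ suc (suc k)         ∎
  where open ≤-Reasoning

2^≤fib[1+double] : ∀ i → 2 ^ i ≤ fib (suc (double i))
2^≤fib[1+double] zero    = ≤-refl
2^≤fib[1+double] (suc i) = begin
  2 ^ i + (2 ^ i + 0)                                           ≡⟨ cong (2 ^ i +_) (+-identityʳ (2 ^ i)) ⟩
  2 ^ i + 2 ^ i                                                 ≤⟨ +-mono-≤ (≤-trans IH (m≤m+n _ _)) IH ⟩
  fib (suc (double i)) + fib (double i) + fib (suc (double i))  ∎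
  where
  open ≤-Reasoning
  IH = 2^≤fib[1+double] i

1+double≤3* : ∀ t → suc (double (suc t)) ≤ 3 * suc t
1+double≤3* zero    = ≤-refl
1+double≤3* (suc t) = begin
  2 + suc (double (suc t)) ≤⟨ +-monoʳ-≤ 2 (1+double≤3* t) ⟩
  2 + 3 * suc t            ≤⟨ n≤1+n _ ⟩
  3 + 3 * suc t            ≡⟨ *-suc 3 (suc t) ⟨
  3 * suc (suc t)          ∎
  where open ≤-Reasoning

1+double≤3*⌈log₂fib[1+double]⌉ : ∀ t
                               → suc (double (suc t)) ≤ 3 * ⌈log₂ fib (suc (double (suc t))) ⌉
1+double≤3*⌈log₂fib[1+double]⌉ t = begin
  suc (double (suc t))                    ≤⟨ 1+double≤3* t ⟩
  3 * suc t                               ≡⟨ cong (3 *_) (⌈log₂2^n⌉≡n (suc t)) ⟨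
  3 * ⌈log₂ 2 ^ suc t ⌉                   ≤⟨ *-monoʳ-≤ 3 (⌈log₂⌉-mono-≤ 2^[1+t]≤h) ⟩
  3 * ⌈log₂ fib (suc (double (suc t))) ⌉  ∎
  where
  open ≤-Reasoning
  2^[1+t]≤h = 2^≤fib[1+double] (suc t)

2^9ℓ²-bound : ∀ ℓ {m N n} → N ≤ suc n → suc n ≤ 3 * ℓ
            → m ≤ suc (fib (suc n)) ^ N → m ≤ 2 ^ (9 * (ℓ * ℓ))
2^9ℓ²-bound ℓ {m} {N} {n} N≤1+n 1+n≤3ℓ m≤ = begin
  m                      ≤⟨ m≤ ⟩
  suc (fib (suc n)) ^ N  ≤⟨ ^-monoˡ-≤ N (fib<2^ (suc n)) ⟩
  (2 ^ suc n) ^ N        ≤⟨ ^-monoʳ-≤ (2 ^ suc n) {{m^n≢0 2 (suc n)}} N≤1+n ⟩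
  (2 ^ suc n) ^ suc n    ≡⟨ ^-*-assoc 2 (suc n) (suc n) ⟩
  2 ^ (suc n * suc n)    ≤⟨ ^-monoʳ-≤ 2 exponent-≤ ⟩
  2 ^ (9 * (ℓ * ℓ))      ∎
  where
  open ≤-Reasoning
  exponent-≤ : suc n * suc n ≤ 9 * (ℓ * ℓ)
  exponent-≤ = begin
    suc n * suc n      ≤⟨ *-mono-≤ 1+n≤3ℓ 1+n≤3ℓ ⟩
    3 * ℓ * (3 * ℓ)    ≡⟨ solve (ℓ ∷ []) ⟩
    9 * (ℓ * ℓ)        ∎

_⊕_ : ℕ × ℕ → ℕ × ℕ → ℕ × ℕ
(a , b) ⊕ (c , d) = a + c , b + d

_≺_ : ℕ × ℕ → ℕ × ℕ → Set
(a , b) ≺ (c , d) = a * d < c * b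

-- Farey neighbours a / b < c / d, i.e. c / d - a / b = 1 / (b d).
Neighbours : ℕ × ℕ → ℕ × ℕ → Set
Neighbours (a , b) (c , d) = b * c ≡ a * d + 1

≺-swap : ∀ {x y} → x ≺ y → swap y ≺ swap x
≺-swap {a , b} {c , d} = subst₂ _<_ (*-comm a d) (*-comm c b)

neighbours-swap : ∀ {x y} → Neighbours x y → Neighbours (swap y) (swap x)
neighbours-swap {a , b} {c , d} bc≡ad+1 = trans (*-comm c b) (trans bc≡ad+1 (cong (_+ 1) (*-comm a d)))

neighbours-⊕ˡ : ∀ {x y} → Neighbours x y → Neighbours x (x ⊕ y)
neighbours-⊕ˡ {a , b} {c , d} bc≡ad+1 = begin
  b * (a + c)          ≡⟨ *-distribˡ-+ b a c ⟩
  b * a + b * c        ≡⟨ cong₂ _+_ (*-comm b a) bc≡ad+1 ⟩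
  a * b + (a * d + 1)  ≡⟨ +-assoc (a * b) (a * d) 1 ⟨
  a * b + a * d + 1    ≡⟨ cong (_+ 1) (*-distribˡ-+ a b d) ⟨
  a * (b + d) + 1      ∎
  where open ≡-Reasoning

neighbours-⊕ʳ : ∀ {x y} → Neighbours x y → Neighbours (y ⊕ x) y
neighbours-⊕ʳ {x} {y} =
  neighbours-swap {swap y} {swap y ⊕ swap x} ∘ neighbours-⊕ˡ {swap y} {swap x} ∘ neighbours-swap {x} {y}

-- u and v are the cross-differences of X / Y with the neighbours a / b < c / d.
farey-decomposition : ∀ {a b c d X Y u v} → b * c ≡ a * d + 1
                    → a * Y + v ≡ X * b → X * d + u ≡ c * Y → X ≡ a * u + c * v
farey-decomposition {a} {b} {c} {d} {X} {Y} {u} {v} bc≡ad+1 aY+v≡Xb Xd+u≡cY =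
  +-cancelˡ-≡ (a * (X * d)) X (a * u + c * v) (begin
    a * (X * d) + X                ≡⟨ solve (a ∷ X ∷ d ∷ []) ⟩
    X * (a * d + 1)                ≡⟨ cong (X *_) bc≡ad+1 ⟨
    X * (b * c)                    ≡⟨ solve (X ∷ b ∷ c ∷ []) ⟩
    c * (X * b)                    ≡⟨ cong (c *_) aY+v≡Xb ⟨
    c * (a * Y + v)                ≡⟨ solve (a ∷ c ∷ Y ∷ v ∷ []) ⟩
    a * (c * Y) + c * v            ≡⟨ cong (λ w → a * w + c * v) Xd+u≡cY ⟨
    a * (X * d + u) + c * v        ≡⟨ solve (a ∷ X ∷ d ∷ u ∷ c ∷ v ∷ []) ⟩
    a * (X * d) + (a * u + c * v)  ∎)
  where open ≡-Reasoning

mediant-numerator-≤ : ∀ {x y z} → Neighbours x y → x ≺ z → z ≺ y → proj₁ (x ⊕ y) ≤ proj₁ z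
mediant-numerator-≤ {a , b} {c , d} {X , Y} bc≡ad+1 aY<Xb Xd<cY = begin
  a + c          ≤⟨ +-mono-≤ (m≤m*n a u {{>-nonZero (m<n⇒0<n∸m Xd<cY)}})
                             (m≤m*n c v {{>-nonZero (m<n⇒0<n∸m aY<Xb)}}) ⟩
  a * u + c * v  ≡⟨ farey-decomposition {a} {b} {c} {d} bc≡ad+1
                      (m+[n∸m]≡n (<⇒≤ aY<Xb)) (m+[n∸m]≡n (<⇒≤ Xd<cY)) ⟨
  X              ∎
  where
  open ≤-Reasoning
  u = c * Y ∸ X * d
  v = X * b ∸ a * Y

mediant-denominator-≤ : ∀ {x y z} → Neighbours x y → x ≺ z → z ≺ y → proj₂ (y ⊕ x) ≤ proj₂ z
mediant-denominator-≤ {x} {y} {z} xy x≺z z≺y =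
  mediant-numerator-≤ {swap y} {swap x} {swap z}
    (neighbours-swap {x} {y} xy) (≺-swap {z} {y} z≺y) (≺-swap {x} {z} x≺z)

lowest-terms-unique : ∀ {a b c d} → Coprime a b → Coprime c d
                    → a * d ≡ c * b → (a , b) ≡ (c , d)
lowest-terms-unique {a} {b} {c} {d} a⊥b c⊥d ad≡cb = cong₂ _,_
  (∣-antisym (coprime-divisor a⊥b (divides d (trans (*-comm b c) (trans (sym ad≡cb) (*-comm a d)))))
             (coprime-divisor c⊥d (divides b (trans (*-comm d a) (trans ad≡cb (*-comm c b))))))
  (∣-antisym (coprime-divisor (Coprime.sym a⊥b) (divides c ad≡cb))
             (coprime-divisor (Coprime.sym c⊥d) (divides a (sym ad≡cb))))

-- Above p q (a , b) and Below p q (a , b) say a / b > log q / log p and a / b < log q / log p.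
Above : ℕ → ℕ → ℕ × ℕ → Set
Above p q (a , b) = q ^ b < p ^ a

Below : ℕ → ℕ → ℕ × ℕ → Set
Below p q x = Above q p (swap x)

above⇒numerator>0 : ∀ {p q a b} → 0 < q → Above p q (a , b) → 0 < a
above⇒numerator>0 {a = zero}  {b} 0<q q^b<1 = ⊥-elim (<⇒≱ q^b<1 (m^n>0 _ {{>-nonZero 0<q}} b))
above⇒numerator>0 {a = suc a} _   _          = z<s

above-⊕-cancelˡ : ∀ {p q} x y → 0 < q → Above p q (x ⊕ y) → Below p q x → Above p q y
above-⊕-cancelˡ {p} {q} (a , b) (c , d) 0<q q^[b+d]<p^[a+c] p^a<q^b =
  ≰⇒> λ p^c≤q^d → <-asym q^[b+d]<p^[a+c] (begin-strict
    p ^ (a + c)    ≡⟨ ^-distribˡ-+-* p a c ⟩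
    p ^ a * p ^ c  ≤⟨ *-monoʳ-≤ (p ^ a) p^c≤q^d ⟩
    p ^ a * q ^ d  <⟨ *-monoˡ-< (q ^ d) {{m^n≢0 q d {{>-nonZero 0<q}}}} p^a<q^b ⟩
    q ^ b * q ^ d  ≡⟨ ^-distribˡ-+-* q b d ⟨
    q ^ (b + d)    ∎)
  where open ≤-Reasoning

below-above⇒≺ : ∀ {p q} x y → 1 < p → Below p q x → Above p q y → x ≺ y
below-above⇒≺ {p} {q} (a , b) (c , d) 1<p p^a<q^b q^d<p^c =
  ≰⇒> λ cb≤ad → <⇒≱ p^[ad]<p^[cb] (^-monoʳ-≤ p {{>-nonZero 0<p}} cb≤ad)
  where
  open ≤-Reasoning
  0<p = <-trans z<s 1<p
  p^[ad]<p^[cb] : p ^ (a * d) < p ^ (c * b)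
  p^[ad]<p^[cb] = begin-strict
    p ^ (a * d)  ≡⟨ ^-*-assoc p a d ⟨
    (p ^ a) ^ d  ≤⟨ ^-monoˡ-≤ d (<⇒≤ p^a<q^b) ⟩
    (q ^ b) ^ d  ≡⟨ ^-*-assoc q b d ⟩
    q ^ (b * d)  ≡⟨ cong (q ^_) (*-comm b d) ⟩
    q ^ (d * b)  ≡⟨ ^-*-assoc q d b ⟨
    (q ^ d) ^ b  <⟨ ^-monoˡ-< b {{>-nonZero (above⇒numerator>0 {q} {p} {b} {a} 0<p p^a<q^b)}} q^d<p^c ⟩
    (p ^ c) ^ b  ≡⟨ ^-*-assoc p c b ⟩
    p ^ (c * b)  ∎

convergent : ℕ → ℕ × ℕ
convergent k = fib (suc k) , fib k

IsConvergentUpTo : ℕ → ℕ × ℕ → Set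
IsConvergentUpTo n x = Σ ℕ λ k → k ≤ n × x ≡ convergent k

convergent-nonZeroPair : ∀ k → NonZeroPair (fib (suc k)) (fib k)
convergent-nonZeroPair k (fib[1+k]≡0 , _) = <⇒≢ (fib[1+k]>0 k) (sym fib[1+k]≡0)

convergent-lex-< : ∀ {j k} → LexLt (convergent j) (convergent k) → j < k
convergent-lex-< (inj₁ h[j]<h[k])            = ≰⇒> (<⇒≱ h[j]<h[k] ∘ fib-mono-≤)
convergent-lex-< (inj₂ (_ , h[1+j]<h[1+k])) = ≰⇒> (<⇒≱ h[1+j]<h[1+k] ∘ fib-mono-≤ ∘ s≤s)

-- The convergents h (2i+1) / h (2i) lie above the golden ratio, h (2i+2) / h (2i+1) below it.
-- By the Fibonacci recurrence, up (suc i) = low i ⊕ up i and low (suc i) = up (suc i) ⊕ low i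
-- hold definitionally.
up low : ℕ → ℕ × ℕ
up i  = convergent (double i)
low i = convergent (suc (double i))

low-up-neighbours     : ∀ i → Neighbours (low i) (up i)
low-up-suc-neighbours : ∀ i → Neighbours (low i) (up (suc i))
low-up-neighbours zero    = refl
low-up-neighbours (suc i) = neighbours-⊕ʳ {low i} {up (suc i)} (low-up-suc-neighbours i)
low-up-suc-neighbours i   = neighbours-⊕ˡ {low i} {up i} (low-up-neighbours i)

-- Imported only here: more constructors named [] and _∷_ would make the variable lists passed to
-- solve above ambiguous.
open import Data.List.Relation.Unary.All as All using (All; []; _∷_)
open import Data.List.Relation.Unary.Linked using (Linked; [-]; _∷_)
open import Data.Vec using (Vec; []; _∷_)
import Data.Vec as Vec
open import Data.Vec.Relation.Unary.All as VecAll using ([]; _∷_)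
open import Data.Vec.Recursive using (Fin[m^n]↔Fin[m]^n)
open import Data.Vec.Recursive.Properties using (↔Vec)

module _ {p q t : ℕ} (1<p : 1 < p) (1<q : 1 < q)
         (below : Below p q (low t)) (above : Above p q (up (suc t))) where

  private
    0<p : 0 < p
    0<p = <-trans z<s 1<p

    0<q : 0 < q
    0<q = <-trans z<s 1<q

  Sides : ℕ → Set
  Sides i = Above p q (up (suc i)) × Below p q (low i)

  sides : ∀ {i} → i ≤ t → Sides i
  sides i≤t = ≤-downward-induction {Sides} (λ {i} → descend {i}) i≤t (above , below)
    where
    descend : ∀ {i} → Sides (suc i) → Sides i
    descend {i} (up-above , low-below) =
      up-above′ , above-⊕-cancelˡ (swap (up (suc i))) (swap (low i)) 0<p low-below up-above′
      where
      up-above′ = above-⊕-cancelˡ (low (suc i)) (up (suc i)) 0<q up-above low-below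

  up-above : ∀ {i} → i ≤ suc t → Above p q (up i)
  up-above {zero}  _   = ≤-trans 1<p (≤-reflexive (sym (*-identityʳ p)))
  up-above {suc i} i<T = proj₁ (sides (≤-pred i<T))

  low-below : ∀ {i} → i ≤ t → Below p q (low i)
  low-below = proj₂ ∘ sides

  upper-step : ∀ {a b i} → Coprime a b → InU1 p q a b → i < suc t → proj₁ (up i) ≤ a
             → (a , b) ≡ up i ⊎ proj₁ (up (suc i)) ≤ a
  upper-step {a} {b} {i} a⊥b ((_ , ab-above) , minimal) i<T upᵢ≤a
    with m≤n⇒m<n∨m≡n (minimal _ _ (convergent-nonZeroPair (double i) , up-above (<⇒≤ i<T)) upᵢ≤a)
  ... | inj₂ same-ratio = inj₁ (lowest-terms-unique a⊥b (consecutive-fib-coprime (double i)) same-ratio)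
  ... | inj₁ ab≺upᵢ     =
    inj₂ (mediant-numerator-≤ {low i} {up i} {a , b} (low-up-neighbours i) lowᵢ≺ab ab≺upᵢ)
    where
    lowᵢ≺ab = below-above⇒≺ (low i) (a , b) 1<p (low-below (≤-pred i<T)) ab-above

  upper-best-is-convergent : ∀ {a b} → Coprime a b → InU1 p q a b
                           → a ≤ proj₁ (up (suc t)) → b ≤ proj₂ (up (suc t))
                           → IsConvergentUpTo (double (suc t)) (a , b)
  upper-best-is-convergent {a} {b} a⊥b best@((_ , ab-above) , minimal) a≤A b≤B
    with climb (suc t) ≤-refl
    where
    climb : ∀ i → i ≤ suc t → IsConvergentUpTo (double (suc t)) (a , b) ⊎ proj₁ (up i) ≤ a
    climb zero    _   = inj₂ (above⇒numerator>0 {p} {q} {a} {b} 0<q ab-above)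
    climb (suc i) i<T with climb i (<⇒≤ i<T)
    ... | inj₁ convergent = inj₁ convergent
    ... | inj₂ upᵢ≤a      =
      map₁ (λ ab≡upᵢ → double i , double-mono-≤ (<⇒≤ i<T) , ab≡upᵢ)
           (upper-step a⊥b best i<T upᵢ≤a)
  ... | inj₁ convergent = convergent
  ... | inj₂ A≤a        = double (suc t) , ≤-refl , cong₂ _,_ a≡A (≤-antisym b≤B B≤b)
    where
    a≡A = ≤-antisym a≤A A≤a
    B≤b = *-cancelˡ-≤ (proj₁ (up (suc t))) {{>-nonZero (fib[1+k]>0 (double (suc t)))}}
            (subst (λ a → a * proj₂ (up (suc t)) ≤ proj₁ (up (suc t)) * b) a≡A
              (minimal _ _ (convergent-nonZeroPair (double (suc t)) , above) A≤a))

  lower-step : ∀ {a b i} → Coprime a b → InL2 p q a b → i < suc t → proj₂ (low i) ≤ b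
             → (a , b) ≡ low i ⊎ proj₂ (low (suc i)) ≤ b
  lower-step {a} {b} {i} a⊥b ((_ , ab-below) , maximal) i<T lowᵢ≤b
    with m≤n⇒m<n∨m≡n (maximal _ _ (convergent-nonZeroPair (suc (double i)) , low-below (≤-pred i<T)) lowᵢ≤b)
  ... | inj₂ same-ratio =
    inj₁ (sym (lowest-terms-unique (consecutive-fib-coprime (suc (double i))) a⊥b same-ratio))
  ... | inj₁ lowᵢ≺ab    =
    inj₂ (mediant-denominator-≤ {low i} {up (suc i)} {a , b} (low-up-suc-neighbours i) lowᵢ≺ab ab≺upᵢ₊₁)
    where
    ab≺upᵢ₊₁ = below-above⇒≺ (a , b) (up (suc i)) 1<p ab-below (up-above i<T)

  lower-best-is-convergent : ∀ {a b} → Coprime a b → InL2 p q a b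
                           → b ≤ proj₂ (up (suc t)) → IsConvergentUpTo (double (suc t)) (a , b)
  lower-best-is-convergent {a} {b} a⊥b best@((_ , ab-below) , _) b≤B with climb (suc t) ≤-refl
    where
    climb : ∀ i → i ≤ suc t → IsConvergentUpTo (double (suc t)) (a , b) ⊎ proj₂ (low i) ≤ b
    climb zero    _   = inj₂ (above⇒numerator>0 {q} {p} {b} {a} 0<p ab-below)
    climb (suc i) i<T with climb i (<⇒≤ i<T)
    ... | inj₁ convergent = inj₁ convergent
    ... | inj₂ lowᵢ≤b     =
      map₁ (λ ab≡lowᵢ → suc (double i) , m≤n⇒m≤1+n (s≤s (double-mono-≤ (≤-pred i<T))) , ab≡lowᵢ)
           (lower-step a⊥b best i<T lowᵢ≤b)
  ... | inj₁ convergent  = convergent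
  ... | inj₂ B+h[2t+1]≤b = ⊥-elim (<⇒≱ (m<m+n _ (fib[1+k]>0 (double t))) (≤-trans B+h[2t+1]≤b b≤B))

  best-approximation-is-convergent : ∀ {a b}
    → IsBestApprox p q a b × a ≤ proj₁ (up (suc t)) × b ≤ proj₂ (up (suc t))
    → IsConvergentUpTo (double (suc t)) (a , b)
  best-approximation-is-convergent ((a⊥b , inj₁ upper) , a≤A , b≤B) =
    upper-best-is-convergent a⊥b upper a≤A b≤B
  best-approximation-is-convergent ((a⊥b , inj₂ lower) , _   , b≤B) =
    lower-best-is-convergent a⊥b lower b≤B

  best-approximations-are-convergents : ∀ {L}
    → IsBestApproxList p q (proj₁ (up (suc t))) (proj₂ (up (suc t))) L
    → All (IsConvergentUpTo (double (suc t))) L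
  best-approximations-are-convergents (complete , _) =
    All.tabulate λ {(a , b)} → best-approximation-is-convergent ∘ Equivalence.to (complete a b)

convergents-length-from : ∀ {n k xs} → k ≤ n → All (IsConvergentUpTo n) xs
                        → Linked LexLt (convergent k ∷ xs) → k + length (convergent k ∷ xs) ≤ suc n
convergents-length-from {n} {k} k≤n [] [-] = begin
  k + 1  ≡⟨ +-comm k 1 ⟩
  suc k  ≤⟨ s≤s k≤n ⟩
  suc n  ∎
  where open ≤-Reasoning
convergents-length-from {n} {k} {_ ∷ xs} k≤n ((j , j≤n , refl) ∷ convergents) (k≺j ∷ linked) = begin
  k + suc (length (convergent j ∷ xs))  ≡⟨ +-suc k _ ⟩
  suc k + length (convergent j ∷ xs)    ≤⟨ +-monoˡ-≤ _ (convergent-lex-< {k} {j} k≺j) ⟩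
  j + length (convergent j ∷ xs)        ≤⟨ convergents-length-from j≤n convergents linked ⟩
  suc n                                 ∎
  where open ≤-Reasoning

convergents-length : ∀ {n L} → All (IsConvergentUpTo n) L → Linked LexLt L → length L ≤ suc n
convergents-length []                                 _      = z≤n
convergents-length ((k , k≤n , refl) ∷ convergents) linked =
  ≤-trans (m≤n+m _ k) (convergents-length-from k≤n convergents linked)

convergent-numerator>0 : ∀ {n x} → IsConvergentUpTo n x → 0 < proj₁ x
convergent-numerator>0 (k , _ , refl) = fib[1+k]>0 k

factorisation-entries-≤ : ∀ L (x : Vec ℕ (length L)) → All (λ g → 0 < proj₁ g) L
                        → VecAll.All (_≤ proj₁ (T L x)) x
factorisation-entries-≤ []              []       []          = []
factorisation-entries-≤ ((a , b) ∷ L) (x ∷ xs) (0<a ∷ pos) =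
  ≤-trans (m≤m*n x a {{>-nonZero 0<a}}) (m≤m+n (x * a) _)
    ∷ VecAll.map (λ xᵢ≤ → ≤-trans xᵢ≤ (m≤n+m _ (x * a))) (factorisation-entries-≤ L xs pos)

toFins : ∀ {m n} {x : Vec ℕ n} → VecAll.All (_< m) x → Vec (Fin m) n
toFins = VecAll.reduce (λ xᵢ<m → fromℕ< xᵢ<m)

map-toℕ-toFins : ∀ {m n} {x : Vec ℕ n} (x<m : VecAll.All (_< m) x) → Vec.map toℕ (toFins x<m) ≡ x
map-toℕ-toFins []           = refl
map-toℕ-toFins (xᵢ<m ∷ x<m) = cong₂ _∷_ (toℕ-fromℕ< xᵢ<m) (map-toℕ-toFins x<m)

factorisations↣entries : ∀ {L a b} → All (λ g → 0 < proj₁ g) L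
                       → FactVec L a b ↣ Vec (Fin (suc a)) (length L)
factorisations↣entries {L} {a} {b} pos = mk↣ {to = entries} injective
  where
  bounded : (v : FactVec L a b) → VecAll.All (_< suc a) (proj₁ v)
  bounded (x , Tx≡ab) =
    VecAll.map (λ xᵢ≤ → s≤s (≤-trans xᵢ≤ (≤-reflexive (cong proj₁ Tx≡ab))))
               (factorisation-entries-≤ L x pos)
  entries : FactVec L a b → Vec (Fin (suc a)) (length L)
  entries = toFins ∘ bounded
  injective : ∀ {v w} → entries v ≡ entries w → v ≡ w
  injective {v} {w} eq = Σ-≡,≡→≡ (x≡y , uip _ _)
    where
    open ≡-Reasoning
    x≡y = begin
      proj₁ v                          ≡⟨ map-toℕ-toFins (bounded v) ⟨
      Vec.map toℕ (toFins (bounded v)) ≡⟨ cong (Vec.map toℕ) eq ⟩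
      Vec.map toℕ (toFins (bounded w)) ≡⟨ map-toℕ-toFins (bounded w) ⟩
      proj₁ w                          ∎

factorisations-≤ : ∀ {L a b m} → All (λ g → 0 < proj₁ g) L
                 → Fin m ↔ FactVec L a b → m ≤ suc a ^ length L
factorisations-≤ {L} {a} {m = m} pos m↔V = injective⇒≤ (Injection.injective fin↣fin)
  where
  vectors↣fin : Vec (Fin (suc a)) (length L) ↣ Fin (suc a ^ length L)
  vectors↣fin = ↔⇒↣ (↔-sym (↔Vec (length L) ↔-∘ Fin[m^n]↔Fin[m]^n (suc a) (length L)))
  fin↣fin : Fin m ↣ Fin (suc a ^ length L)
  fin↣fin = (vectors↣fin ↣-∘ factorisations↣entries pos) ↣-∘ ↔⇒↣ m↔V

prime>1 : ∀ {p} → Prime p → 1 < p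
prime>1 {p} p-prime = nonTrivial⇒n>1 p {{prime⇒nonTrivial p-prime}}

theorem4p7 : Σ ℕ λ C → ∀ (n p q : ℕ) → 2 ∣ n → 2 ≤ n → Prime p → Prime q
    → p ^ fib n < q ^ fib (n ∸ 1)
    → q ^ fib n < p ^ fib (suc n)
    → (L : List (ℕ × ℕ)) → IsBestApproxList p q (fib (suc n)) (fib n) L
    → (m : ℕ) → (Fin m ↔ FactVec L (fib (suc n)) (fib n))
    → m ≤ 2 ^ (C * (⌈log₂ fib (suc n) ⌉ * ⌈log₂ fib (suc n) ⌉))
theorem4p7 = 9 , λ n p q 2∣n 2≤n → case even⇒double 2∣n 2≤n of λ where
  (t , refl) p-prime q-prime below above L best-list m m↔V →
    let convergents = best-approximations-are-convergents (prime>1 p-prime) (prime>1 q-prime)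
                        below above best-list
    in 2^9ℓ²-bound ⌈log₂ fib (suc (double (suc t))) ⌉
         (convergents-length convergents (proj₂ best-list))
         (1+double≤3*⌈log₂fib[1+double]⌉ t)
         (factorisations-≤ (All.map convergent-numerator>0 convergents) m↔V)
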